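{- Let \(w_2,w_3\) be integers with \(1 \leq w_2 \leq w_3\), and let \(T \in \mathcal{S}_{1,w_2,w_3}\) (defined in the context). Then the multi-width of \(T\) is \((1,w_2,w_3)\).
   Context: Lattice polytope: convex hull of finitely many points of \(\mathbb{Z}^3\). For \(u\in(\mathbb{Z}^3)^*\), \(\mathrm{width}_u(P)=\max_{x\in P}u\cdot x-\min_{x\in P}u\cdot x\); the multi-width is the lexicographically minimal tuple \((\mathrm{width}_{u_1}(P),\mathrm{width}_{u_2}(P),\mathrm{width}_{u_3}(P))\) over linearly independent \(u_1,u_2,u_3\in(\mathbb{Z}^3)^*\). \((n\bmod a)\) is the residue in \(\{0,\dots,a-1\}\); \(0\) is the origin. Triangle set: for integers \(0<a\le b\), \(\mathcal{S}_{a,b}\) is the set of lattice triangles in \(\mathbb{R}^2\) equal to one of: (i) \(\mathrm{conv}(0,(a,y_1),(0,b))\), integer \(y_1\ge 0\) with \(y_1\le (b-y_1\bmod a)\); (ii) \(\mathrm{conv}(0,(a,y_1),(x_2,b))\), integers \(0<x_2\le a/2\), \(0\le y_1\le a-x_2\), and \(y_1\ge x_2\) if \(a=b\); (iii) \(\mathrm{conv}((0,y_0),(a,0),(x_2,b))\), integers \(1<x_2<a/2\), \(0<y_0<x_2\), only when \(a<b\). \(\mathcal{S}_{1,w_2,w_3}\): when \(w_3\ge w_2>1\), the tetrahedra (integer parameters) (1) \(\mathrm{conv}(\{0\}\times t,(1,0,0))\), \(t\in\mathcal{S}_{w_2,w_3}\); (2) \(\mathrm{conv}(0,(0,w_2,z_1),(1,0,0),(1,0,w_3))\),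 \(0\le z_1\le w_2/2\); (3) \(\mathrm{conv}(0,(0,w_2,z_1),(1,0,w_3),(1,y_1,0))\), \(0<y_1\le w_2\), \(w_3-w_2\le z_1\le w_3\); (4) \(\mathrm{conv}(0,(0,w_2,w_3),(1,0,w_3),(1,y_1,z_1))\), \(0<z_1<y_1<w_2\); if \(w_3=w_2\) additionally \(y_1\le z_1\) in (3) and \(z_1\le w_2-y_1\) in (4). When \(w_3>w_2=1\): \(\mathcal{S}_{1,1,w_3}=\{\mathrm{conv}(0,(0,1,0),(0,0,w_3),(1,0,0)),\mathrm{conv}(0,(0,1,w_3-1),(1,0,w_3),(1,1,0)),\mathrm{conv}(0,(0,1,w_3),(1,0,w_3),(1,1,0))\}\). \(\mathcal{S}_{1,1,1}=\{\mathrm{conv}(0,(1,0,0),(0,1,0),(0,0,1)),\mathrm{conv}(0,(0,1,1),(1,0,1),(1,1,0))\}\). -}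

module Defs where

open import Data.Nat as ℕ using (ℕ; zero; suc)
open import Data.Integer using (ℤ; +_; _+_; _-_; _*_; _≤_; _<_; _⊔_; _⊓_; _%ℕ_)
open import Data.Product using (_×_; _,_; Σ; ∃; ∃-syntax)
open import Data.Sum using (_⊎_)
open import Data.Vec using (Vec; []; _∷_)
open import Relation.Binary.PropositionalEquality using (_≡_)

Pt2 : Set
Pt2 = ℤ × ℤ

Pt3 : Set
Pt3 = ℤ × ℤ × ℤ

-- residue (n mod a) in {0,…,a-1}, used only for a > 0
res : ℤ → ℕ → ℕ
res n zero    = 0
res n (suc k) = n %ℕ suc k

-- a lattice tetrahedron is given by its four generating points (P = conv of them)
Tet : Set
Tet = Vec Pt3 4

Tri : Set
Tri = Pt2 × Pt2 × Pt2

_·_ : Pt3 → Pt3 → ℤ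
(a , b , c) · (x , y , z) = a * x + b * y + c * z

-- max / min of u·x over the generating points (= over the convex hull)
maxOn : Pt3 → Tet → ℤ
maxOn u (p ∷ q ∷ r ∷ s ∷ []) = (u · p) ⊔ (u · q) ⊔ (u · r) ⊔ (u · s)

minOn : Pt3 → Tet → ℤ
minOn u (p ∷ q ∷ r ∷ s ∷ []) = (u · p) ⊓ (u · q) ⊓ (u · r) ⊓ (u · s)

width : Pt3 → Tet → ℤ
width u P = maxOn u P - minOn u P

infixl 6 _⊕_
infixr 7 _⊛_
infix 7 _·_

_⊕_ : Pt3 → Pt3 → Pt3
(a , b , c) ⊕ (x , y , z) = (a + x , b + y , c + z)

_⊛_ : ℤ → Pt3 → Pt3
k ⊛ (x , y , z) = (k * x , k * y , k * z)

0ᵥ : Pt3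
0ᵥ = (+ 0 , + 0 , + 0)

LinIndep : Pt3 → Pt3 → Pt3 → Set
LinIndep u₁ u₂ u₃ =
  ∀ (c₁ c₂ c₃ : ℤ) → (c₁ ⊛ u₁) ⊕ (c₂ ⊛ u₂) ⊕ (c₃ ⊛ u₃) ≡ 0ᵥ →
    (c₁ ≡ + 0) × (c₂ ≡ + 0) × (c₃ ≡ + 0)

_≤lex_ : ℤ × ℤ × ℤ → ℤ × ℤ × ℤ → Set
(a , b , c) ≤lex (a' , b' , c') =
  a < a' ⊎ (a ≡ a' × (b < b' ⊎ (b ≡ b' × c ≤ c')))

widths : Tet → Pt3 → Pt3 → Pt3 → ℤ × ℤ × ℤ
widths P u₁ u₂ u₃ = (width u₁ P , width u₂ P , width u₃ P)

IsMultiWidth : Tet → ℤ × ℤ × ℤ → Set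
IsMultiWidth P m =
  (∃[ u₁ ] ∃[ u₂ ] ∃[ u₃ ] (LinIndep u₁ u₂ u₃ × widths P u₁ u₂ u₃ ≡ m))
  × (∀ u₁ u₂ u₃ → LinIndep u₁ u₂ u₃ → m ≤lex widths P u₁ u₂ u₃)

ℤ0 ℤ1 : ℤ
ℤ0 = + 0
ℤ1 = + 1

data S₂ (a b : ℕ) : Tri → Set where
  s-i   : ∀ (y₁ : ℤ) → ℤ0 ≤ y₁ → y₁ ≤ + res (+ b - y₁) a →
          S₂ a b ((ℤ0 , ℤ0) , (+ a , y₁) , (ℤ0 , + b))
  s-ii  : ∀ (x₂ y₁ : ℤ) → ℤ0 < x₂ → (+ 2) * x₂ ≤ + a →
          ℤ0 ≤ y₁ → y₁ ≤ + a - x₂ → (a ≡ b → x₂ ≤ y₁) →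
          S₂ a b ((ℤ0 , ℤ0) , (+ a , y₁) , (x₂ , + b))
  s-iii : ∀ (x₂ y₀ : ℤ) → ℤ1 < x₂ → (+ 2) * x₂ < + a →
          ℤ0 < y₀ → y₀ < x₂ → a ℕ.< b →
          S₂ a b ((ℤ0 , y₀) , (+ a , ℤ0) , (x₂ , + b))

data S₃ (w₂ w₃ : ℕ) : Tet → Set where
  t1 : 1 ℕ.< w₂ → w₂ ℕ.≤ w₃ →
       ∀ (p q r : Pt2) → S₂ w₂ w₃ (p , q , r) →
       S₃ w₂ w₃ ((ℤ0 , p) ∷ (ℤ0 , q) ∷ (ℤ0 , r) ∷ (ℤ1 , ℤ0 , ℤ0) ∷ [])
  t2 : 1 ℕ.< w₂ → w₂ ℕ.≤ w₃ →
       ∀ (z₁ : ℤ) → ℤ0 ≤ z₁ → (+ 2) * z₁ ≤ + w₂ →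
       S₃ w₂ w₃ (0ᵥ ∷ (ℤ0 , + w₂ , z₁) ∷ (ℤ1 , ℤ0 , ℤ0) ∷ (ℤ1 , ℤ0 , + w₃) ∷ [])
  t3 : 1 ℕ.< w₂ → w₂ ℕ.≤ w₃ →
       ∀ (y₁ z₁ : ℤ) → ℤ0 < y₁ → y₁ ≤ + w₂ →
       + w₃ - + w₂ ≤ z₁ → z₁ ≤ + w₃ → (w₃ ≡ w₂ → y₁ ≤ z₁) →
       S₃ w₂ w₃ (0ᵥ ∷ (ℤ0 , + w₂ , z₁) ∷ (ℤ1 , ℤ0 , + w₃) ∷ (ℤ1 , y₁ , ℤ0) ∷ [])
  t4 : 1 ℕ.< w₂ → w₂ ℕ.≤ w₃ →
       ∀ (y₁ z₁ : ℤ) → ℤ0 < z₁ → z₁ < y₁ → y₁ < + w₂ →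
       (w₃ ≡ w₂ → z₁ ≤ + w₂ - y₁) →
       S₃ w₂ w₃ (0ᵥ ∷ (ℤ0 , + w₂ , + w₃) ∷ (ℤ1 , ℤ0 , + w₃) ∷ (ℤ1 , y₁ , z₁) ∷ [])
  u1 : w₂ ≡ 1 → 1 ℕ.< w₃ →
       S₃ w₂ w₃ (0ᵥ ∷ (ℤ0 , ℤ1 , ℤ0) ∷ (ℤ0 , ℤ0 , + w₃) ∷ (ℤ1 , ℤ0 , ℤ0) ∷ [])
  u2 : w₂ ≡ 1 → 1 ℕ.< w₃ →
       S₃ w₂ w₃ (0ᵥ ∷ (ℤ0 , ℤ1 , + w₃ - ℤ1) ∷ (ℤ1 , ℤ0 , + w₃) ∷ (ℤ1 , ℤ1 , ℤ0) ∷ [])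
  u3 : w₂ ≡ 1 → 1 ℕ.< w₃ →
       S₃ w₂ w₃ (0ᵥ ∷ (ℤ0 , ℤ1 , + w₃) ∷ (ℤ1 , ℤ0 , + w₃) ∷ (ℤ1 , ℤ1 , ℤ0) ∷ [])
  v1 : w₂ ≡ 1 → w₃ ≡ 1 →
       S₃ w₂ w₃ (0ᵥ ∷ (ℤ1 , ℤ0 , ℤ0) ∷ (ℤ0 , ℤ1 , ℤ0) ∷ (ℤ0 , ℤ0 , ℤ1) ∷ [])
  v2 : w₂ ≡ 1 → w₃ ≡ 1 →
       S₃ w₂ w₃ (0ᵥ ∷ (ℤ0 , ℤ1 , ℤ1) ∷ (ℤ1 , ℤ0 , ℤ1) ∷ (ℤ1 , ℤ1 , ℤ0) ∷ [])

module Submission where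

-- Every T in S_{1,w₂,w₃} lies in the box [0,1] × [0,w₂] × [0,w₃], so the coordinate functionals
-- e₁, e₂, e₃ have widths at most (1, w₂, w₃). Conversely, a functional u = (a, b, c) increases by at
-- least w₃ between two vertices of T when c ≠ 0, by at least w₂ when c = 0 and b ≠ 0, and by at
-- least 1 when u = (a, 0, 0) ≠ 0: replacing u by -u the last nonzero coordinate is positive, and the
-- two vertices are chosen according to the sign of b. So a functional of width below w₃ lies in the
-- plane c = 0, and one of width below w₂ on the line b = c = 0. Three independent functionals do not
-- all lie in that plane and no two of them lie on that line, which gives the lexicographic bound.
-- The conditions of S that only apply when w₂ = w₃ are never used.

open import Data.Fin using (Fin; zero; suc; #_)
open import Data.Integer
  using (ℤ; +_; -[1+_]; +[1+_]; _+_; _-_; _*_; -_; _≤_; _<_; +≤+; +<+; -≤+; nonNegative; nonPositive)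
open import Data.Integer.DivMod using (n%ℕd<d)
open import Data.Integer.Properties
open import Data.Integer.Tactic.RingSolver using (solve-∀)
open import Data.Nat as ℕ using (ℕ; z≤n; s≤s)
import Data.Nat.Properties as ℕ
open import Data.Product using (_×_; _,_; proj₁; proj₂; uncurry)
open import Data.Sum using (inj₁; inj₂)
open import Data.Vec using (_∷_; []; lookup)
open import Data.Vec.Relation.Unary.All as All using (All; _∷_; [])
open import Function using (_∘_)
open import Relation.Binary.Definitions using (tri<; tri≈; tri>)
open import Relation.Binary.PropositionalEquality
  using (_≡_; _≢_; refl; sym; trans; cong; cong₂; subst; subst₂)
open import Relation.Nullary using (¬_; yes; no; contradiction)

open import Defs

≤maxOn : ∀ u T i → u · lookup T i ≤ maxOn u T
≤maxOn u (_ ∷ _ ∷ _ ∷ _ ∷ []) zero                   = i≤j⇒i≤j⊔k _ (i≤j⇒i≤j⊔k _ (i≤i⊔j _ _))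
≤maxOn u (_ ∷ _ ∷ _ ∷ _ ∷ []) (suc zero)             = i≤j⇒i≤j⊔k _ (i≤j⇒i≤j⊔k _ (i≤j⊔i _ _))
≤maxOn u (_ ∷ _ ∷ _ ∷ _ ∷ []) (suc (suc zero))       = i≤j⇒i≤j⊔k _ (i≤j⊔i _ _)
≤maxOn u (_ ∷ _ ∷ _ ∷ _ ∷ []) (suc (suc (suc zero))) = i≤j⊔i _ _

minOn≤ : ∀ u T i → minOn u T ≤ u · lookup T i
minOn≤ u (_ ∷ _ ∷ _ ∷ _ ∷ []) zero                   = i≤j⇒i⊓k≤j _ (i≤j⇒i⊓k≤j _ (i⊓j≤i _ _))
minOn≤ u (_ ∷ _ ∷ _ ∷ _ ∷ []) (suc zero)             = i≤j⇒i⊓k≤j _ (i≤j⇒i⊓k≤j _ (i⊓j≤j _ _))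
minOn≤ u (_ ∷ _ ∷ _ ∷ _ ∷ []) (suc (suc zero))       = i≤j⇒i⊓k≤j _ (i⊓j≤j _ _)
minOn≤ u (_ ∷ _ ∷ _ ∷ _ ∷ []) (suc (suc (suc zero))) = i⊓j≤j _ _

maxOn≤ : ∀ {u T M} → All (λ p → u · p ≤ M) T → maxOn u T ≤ M
maxOn≤ (p ∷ q ∷ r ∷ s ∷ []) = ⊔-lub (⊔-lub (⊔-lub p q) r) s

≤minOn : ∀ {u T m} → All (λ p → m ≤ u · p) T → m ≤ minOn u T
≤minOn (p ∷ q ∷ r ∷ s ∷ []) = ⊓-glb (⊓-glb (⊓-glb p q) r) s

infix 4 _∈[0,_]
_∈[0,_] : ℤ → ℤ → Set
x ∈[0, w ] = ℤ0 ≤ x × x ≤ w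

range⇒width≤ : ∀ {u T w} → All (λ p → u · p ∈[0, w ]) T → width u T ≤ w
range⇒width≤ {u} {T} {w} range = begin
  maxOn u T - minOn u T ≤⟨ +-mono-≤ (maxOn≤ (All.map proj₂ range)) (neg-mono-≤ (≤minOn (All.map proj₁ range))) ⟩
  w - ℤ0                ≡⟨ +-identityʳ w ⟩
  w                     ∎
  where open ≤-Reasoning

record Rise (u : Pt3) (T : Tet) (k : ℤ) : Set where
  constructor rise
  field
    top bottom : Fin 4
    k≤rise     : k ≤ u · lookup T top - u · lookup T bottom

rise⇒≤width : ∀ {u T k} → Rise u T k → k ≤ width u T
rise⇒≤width {u} {T} (rise i j k≤rise) =
  ≤-trans k≤rise (+-mono-≤ (≤maxOn u T i) (neg-mono-≤ (minOn≤ u T j)))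

rise⇒width≮ : ∀ {u T k} → Rise u T k → ¬ width u T < k
rise⇒width≮ r W<k = <⇒≱ W<k (rise⇒≤width r)

-ᵥ_ : Pt3 → Pt3
-ᵥ (a , b , c) = (- a , - b , - c)

-ᵥ-·-difference : ∀ u p q → (-ᵥ u) · p - (-ᵥ u) · q ≡ u · q - u · p
-ᵥ-·-difference (a , b , c) (x , y , z) (x′ , y′ , z′) = identity a b c x y z x′ y′ z′
  where
  identity : ∀ a b c x y z x′ y′ z′ →
    (- a) * x + (- b) * y + (- c) * z - ((- a) * x′ + (- b) * y′ + (- c) * z′)
      ≡ a * x′ + b * y′ + c * z′ - (a * x + b * y + c * z)
  identity = solve-∀

rise-from-negation : ∀ {u T k} → Rise (-ᵥ u) T k → Rise u T k
rise-from-negation {u} {T} (rise i j k≤rise) =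
  rise j i (subst (_ ≤_) (-ᵥ-·-difference u (lookup T i) (lookup T j)) k≤rise)

OnAxis InPlane : Pt3 → Set
OnAxis  (_ , b , c) = b ≡ ℤ0 × c ≡ ℤ0
InPlane (_ , _ , c) = c ≡ ℤ0

≡0ᵥ : ∀ {x y z} → x ≡ ℤ0 → y ≡ ℤ0 → z ≡ ℤ0 → (x , y , z) ≡ 0ᵥ
≡0ᵥ x≡0 y≡0 z≡0 = cong₂ _,_ x≡0 (cong₂ _,_ y≡0 z≡0)

⊕-swap : ∀ p q r → p ⊕ q ⊕ r ≡ p ⊕ r ⊕ q
⊕-swap (x , y , z) (x′ , y′ , z′) (x″ , y″ , z″) =
  cong₂ _,_ (swap x x′ x″) (cong₂ _,_ (swap y y′ y″) (swap z z′ z″))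
  where
  swap : ∀ i j k → i + j + k ≡ i + k + j
  swap = solve-∀

LinIndep-swap₂₃ : ∀ {u v w} → LinIndep u v w → LinIndep u w v
LinIndep-swap₂₃ {u} {v} {w} ind c₁ c₂ c₃ combination≡0
  with ind c₁ c₃ c₂ (trans (⊕-swap (c₁ ⊛ u) (c₃ ⊛ v) (c₂ ⊛ w)) combination≡0)
... | c₁≡0 , c₃≡0 , c₂≡0 = c₁≡0 , c₂≡0 , c₃≡0

LinIndep⇒≢0ᵥ₁ : ∀ {u v w} → LinIndep u v w → u ≢ 0ᵥ
LinIndep⇒≢0ᵥ₁ {v = _ , _ , _} {_ , _ , _} ind refl with ind ℤ1 ℤ0 ℤ0 refl
... | () , _

LinIndep⇒≢0ᵥ₂ : ∀ {u v w} → LinIndep u v w → v ≢ 0ᵥ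
LinIndep⇒≢0ᵥ₂ {_ , _ , _} {w = _ , _ , _} ind refl with ind ℤ0 ℤ1 ℤ0 refl
... | _ , () , _

LinIndep⇒≢0ᵥ₃ : ∀ {u v w} → LinIndep u v w → w ≢ 0ᵥ
LinIndep⇒≢0ᵥ₃ ind = LinIndep⇒≢0ᵥ₂ (LinIndep-swap₂₃ ind)

sum-*0 : ∀ c₁ c₂ c₃ → c₁ * ℤ0 + c₂ * ℤ0 + c₃ * ℤ0 ≡ ℤ0
sum-*0 = solve-∀

parallel⇒¬LinIndep : ∀ {a₁ b₁ a₂ b₂ w} → a₁ * b₂ - a₂ * b₁ ≡ ℤ0 →
                      ¬ LinIndep (a₁ , b₁ , ℤ0) (a₂ , b₂ , ℤ0) w
parallel⇒¬LinIndep {a₁} {b₁} {a₂} {b₂} {x , y , _} det≡0 ind with a₁ ≟ ℤ0 | b₁ ≟ ℤ0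
... | no a₁≢0 | _ =
  a₁≢0 (neg-injective (proj₁ (proj₂ (ind a₂ (- a₁) ℤ0
    (≡0ᵥ (cancel a₁ a₂ x) (trans (cross a₁ b₁ a₂ b₂ y) (cong -_ det≡0)) (sum-*0 a₂ (- a₁) ℤ0))))))
  where
  cancel : ∀ a₁ a₂ x → a₂ * a₁ + (- a₁) * a₂ + ℤ0 * x ≡ ℤ0
  cancel = solve-∀
  cross : ∀ a₁ b₁ a₂ b₂ y → a₂ * b₁ + (- a₁) * b₂ + ℤ0 * y ≡ - (a₁ * b₂ - a₂ * b₁)
  cross = solve-∀
... | yes refl | no b₁≢0 =
  b₁≢0 (neg-injective (proj₁ (proj₂ (ind b₂ (- b₁) ℤ0
    (≡0ᵥ (trans (cross b₁ a₂ b₂ x) det≡0) (cancel b₁ b₂ y) (sum-*0 b₂ (- b₁) ℤ0))))))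
  where
  cross : ∀ b₁ a₂ b₂ x → b₂ * ℤ0 + (- b₁) * a₂ + ℤ0 * x ≡ ℤ0 * b₂ - a₂ * b₁
  cross = solve-∀
  cancel : ∀ b₁ b₂ y → b₂ * b₁ + (- b₁) * b₂ + ℤ0 * y ≡ ℤ0
  cancel = solve-∀
... | yes refl | yes refl = LinIndep⇒≢0ᵥ₁ ind refl

onAxis⇒¬LinIndep₁₂ : ∀ {u v w} → OnAxis u → OnAxis v → ¬ LinIndep u v w
onAxis⇒¬LinIndep₁₂ {a₁ , _ , _} {a₂ , _ , _} (refl , refl) (refl , refl) =
  parallel⇒¬LinIndep (det≡0 a₁ a₂)
  where
  det≡0 : ∀ a₁ a₂ → a₁ * ℤ0 - a₂ * ℤ0 ≡ ℤ0
  det≡0 = solve-∀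

onAxis⇒¬LinIndep₁₃ : ∀ {u v w} → OnAxis u → OnAxis w → ¬ LinIndep u v w
onAxis⇒¬LinIndep₁₃ onAxis-u onAxis-w = onAxis⇒¬LinIndep₁₂ onAxis-u onAxis-w ∘ LinIndep-swap₂₃

-- The coefficients are the 2 × 2 minors of the 3 × 2 matrix with rows (aᵢ, bᵢ) (Cramer's rule).
inPlane⇒¬LinIndep : ∀ {u v w} → InPlane u → InPlane v → InPlane w → ¬ LinIndep u v w
inPlane⇒¬LinIndep {a₁ , b₁ , _} {a₂ , b₂ , _} {a₃ , b₃ , _} refl refl refl ind
  with a₁ * b₂ - a₂ * b₁ ≟ ℤ0
... | yes det≡0 = parallel⇒¬LinIndep det≡0 ind
... | no det≢0 =
  det≢0 (proj₂ (proj₂ (ind (a₂ * b₃ - a₃ * b₂) (a₃ * b₁ - a₁ * b₃) (a₁ * b₂ - a₂ * b₁)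
    (≡0ᵥ (cramerᵃ a₁ b₁ a₂ b₂ a₃ b₃) (cramerᵇ a₁ b₁ a₂ b₂ a₃ b₃)
         (sum-*0 (a₂ * b₃ - a₃ * b₂) (a₃ * b₁ - a₁ * b₃) (a₁ * b₂ - a₂ * b₁))))))
  where
  cramerᵃ : ∀ a₁ b₁ a₂ b₂ a₃ b₃ →
    (a₂ * b₃ - a₃ * b₂) * a₁ + (a₃ * b₁ - a₁ * b₃) * a₂ + (a₁ * b₂ - a₂ * b₁) * a₃ ≡ ℤ0
  cramerᵃ = solve-∀
  cramerᵇ : ∀ a₁ b₁ a₂ b₂ a₃ b₃ →
    (a₂ * b₃ - a₃ * b₂) * b₁ + (a₃ * b₁ - a₁ * b₃) * b₂ + (a₁ * b₂ - a₂ * b₁) * b₃ ≡ ℤ0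
  cramerᵇ = solve-∀

-- Only a positive last nonzero coordinate is required; the other sign follows by rise-from-negation.
record Flag (w₁ w₂ w₃ : ℤ) (T : Tet) : Set where
  constructor mkFlag
  field
    rise₁ : ∀ n → Rise (+[1+ n ] , ℤ0 , ℤ0) T w₁
    rise₂ : ∀ a n → Rise (a , +[1+ n ] , ℤ0) T w₂
    rise₃ : ∀ a b n → Rise (a , b , +[1+ n ]) T w₃

module _ {w₁ w₂ w₃ : ℤ} {T : Tet} (w₁≤w₂ : w₁ ≤ w₂) (w₂≤w₃ : w₂ ≤ w₃) (F : Flag w₁ w₂ w₃ T) where
  open Flag F

  private
    W : Pt3 → ℤ
    W u = width u T

  width<w₃⇒inPlane : ∀ u → W u < w₃ → InPlane u
  width<w₃⇒inPlane (a , b , + 0)      _    = refl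
  width<w₃⇒inPlane (a , b , +[1+ n ]) W<w₃ = contradiction W<w₃ (rise⇒width≮ (rise₃ a b n))
  width<w₃⇒inPlane (a , b , -[1+ n ]) W<w₃ =
    contradiction W<w₃ (rise⇒width≮ (rise-from-negation (rise₃ (- a) (- b) n)))

  width<w₂⇒onAxis : ∀ u → W u < w₂ → OnAxis u
  width<w₂⇒onAxis (a , b , c) W<w₂ with width<w₃⇒inPlane (a , b , c) (<-≤-trans W<w₂ w₂≤w₃)
  width<w₂⇒onAxis (a , + 0      , _) _    | refl = refl , refl
  width<w₂⇒onAxis (a , +[1+ n ] , _) W<w₂ | refl = contradiction W<w₂ (rise⇒width≮ (rise₂ a n))
  width<w₂⇒onAxis (a , -[1+ n ] , _) W<w₂ | refl =
    contradiction W<w₂ (rise⇒width≮ (rise-from-negation (rise₂ (- a) n)))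

  width<w₁⇒≡0ᵥ : ∀ u → W u < w₁ → u ≡ 0ᵥ
  width<w₁⇒≡0ᵥ (a , b , c) W<w₁ with width<w₂⇒onAxis (a , b , c) (<-≤-trans W<w₁ w₁≤w₂)
  width<w₁⇒≡0ᵥ (+ 0      , _ , _) _    | refl , refl = refl
  width<w₁⇒≡0ᵥ (+[1+ n ] , _ , _) W<w₁ | refl , refl = contradiction W<w₁ (rise⇒width≮ (rise₁ n))
  width<w₁⇒≡0ᵥ (-[1+ n ] , _ , _) W<w₁ | refl , refl =
    contradiction W<w₁ (rise⇒width≮ (rise-from-negation (rise₁ n)))

  second-width≮ : ∀ {u₁ u₂ u₃} → LinIndep u₁ u₂ u₃ → W u₁ ≡ w₁ → ¬ W u₂ < w₂
  second-width≮ {u₁} {u₂} ind W₁≡w₁ W₂<w₂ with W u₁ <? w₂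
  ... | yes W₁<w₂ = onAxis⇒¬LinIndep₁₂ (width<w₂⇒onAxis u₁ W₁<w₂) (width<w₂⇒onAxis u₂ W₂<w₂) ind
  ... | no W₁≮w₂ = LinIndep⇒≢0ᵥ₂ ind (width<w₁⇒≡0ᵥ u₂ W₂<w₁)
    where
    W₂<w₁ : W u₂ < w₁
    W₂<w₁ = <-≤-trans W₂<w₂ (≤-trans (≮⇒≥ W₁≮w₂) (≤-reflexive W₁≡w₁))

  third-width≮ : ∀ {u₁ u₂ u₃} → LinIndep u₁ u₂ u₃ → W u₁ ≡ w₁ → W u₂ ≡ w₂ → ¬ W u₃ < w₃
  third-width≮ {u₁} {u₂} {u₃} ind W₁≡w₁ W₂≡w₂ W₃<w₃ with W u₂ <? w₃
  ... | yes W₂<w₃ =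
    inPlane⇒¬LinIndep (width<w₃⇒inPlane u₁ W₁<w₃) (width<w₃⇒inPlane u₂ W₂<w₃)
                      (width<w₃⇒inPlane u₃ W₃<w₃) ind
    where
    W₁<w₃ : W u₁ < w₃
    W₁<w₃ = ≤-<-trans (≤-trans (≤-reflexive W₁≡w₁) (≤-trans w₁≤w₂ (≤-reflexive (sym W₂≡w₂)))) W₂<w₃
  ... | no W₂≮w₃ with W u₁ <? w₂
  ...   | yes W₁<w₂ = onAxis⇒¬LinIndep₁₃ (width<w₂⇒onAxis u₁ W₁<w₂) (width<w₂⇒onAxis u₃ W₃<w₂) ind
    where
    W₃<w₂ : W u₃ < w₂
    W₃<w₂ = <-≤-trans W₃<w₃ (≤-trans (≮⇒≥ W₂≮w₃) (≤-reflexive W₂≡w₂))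
  ...   | no W₁≮w₂ = LinIndep⇒≢0ᵥ₃ ind (width<w₁⇒≡0ᵥ u₃ W₃<w₁)
    where
    W₃<w₁ : W u₃ < w₁
    W₃<w₁ = <-≤-trans W₃<w₃ (≤-trans (≮⇒≥ W₂≮w₃) (≤-trans (≤-reflexive W₂≡w₂)
              (≤-trans (≮⇒≥ W₁≮w₂) (≤-reflexive W₁≡w₁))))

  flag⇒≤lex : ∀ u₁ u₂ u₃ → LinIndep u₁ u₂ u₃ → (w₁ , w₂ , w₃) ≤lex widths T u₁ u₂ u₃
  flag⇒≤lex u₁ u₂ u₃ ind with <-cmp w₁ (W u₁)
  ... | tri< w₁<W₁ _ _ = inj₁ w₁<W₁
  ... | tri> _ _ W₁<w₁ = contradiction (width<w₁⇒≡0ᵥ u₁ W₁<w₁) (LinIndep⇒≢0ᵥ₁ ind)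
  ... | tri≈ _ w₁≡W₁ _ with <-cmp w₂ (W u₂)
  ...   | tri< w₂<W₂ _ _ = inj₂ (w₁≡W₁ , inj₁ w₂<W₂)
  ...   | tri> _ _ W₂<w₂ = contradiction W₂<w₂ (second-width≮ ind (sym w₁≡W₁))
  ...   | tri≈ _ w₂≡W₂ _ =
    inj₂ (w₁≡W₁ , inj₂ (w₂≡W₂ , ≮⇒≥ (third-width≮ ind (sym w₁≡W₁) (sym w₂≡W₂))))

InBox : ℤ × ℤ × ℤ → Pt3 → Set
InBox (w₁ , w₂ , w₃) (x , y , z) = x ∈[0, w₁ ] × y ∈[0, w₂ ] × z ∈[0, w₃ ]

e₁ e₂ e₃ : Pt3
e₁ = (ℤ1 , ℤ0 , ℤ0)
e₂ = (ℤ0 , ℤ1 , ℤ0)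
e₃ = (ℤ0 , ℤ0 , ℤ1)

LinIndep-e : LinIndep e₁ e₂ e₃
LinIndep-e c₁ c₂ c₃ combination≡0 =
  trans (sym (coord₁ c₁ c₂ c₃)) (cong proj₁ combination≡0) ,
  trans (sym (coord₂ c₁ c₂ c₃)) (cong (proj₁ ∘ proj₂) combination≡0) ,
  trans (sym (coord₃ c₁ c₂ c₃)) (cong (proj₂ ∘ proj₂) combination≡0)
  where
  coord₁ : ∀ c₁ c₂ c₃ → c₁ * ℤ1 + c₂ * ℤ0 + c₃ * ℤ0 ≡ c₁
  coord₁ = solve-∀
  coord₂ : ∀ c₁ c₂ c₃ → c₁ * ℤ0 + c₂ * ℤ1 + c₃ * ℤ0 ≡ c₂
  coord₂ = solve-∀
  coord₃ : ∀ c₁ c₂ c₃ → c₁ * ℤ0 + c₂ * ℤ0 + c₃ * ℤ1 ≡ c₃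
  coord₃ = solve-∀

module _ {w₁ w₂ w₃ : ℤ} where

  inBox⇒e₁-range : ∀ {p} → InBox (w₁ , w₂ , w₃) p → e₁ · p ∈[0, w₁ ]
  inBox⇒e₁-range {x , y , z} (x∈ , _ , _) = subst (_∈[0, w₁ ]) (sym (e₁·p≡x x y z)) x∈
    where
    e₁·p≡x : ∀ x y z → ℤ1 * x + ℤ0 * y + ℤ0 * z ≡ x
    e₁·p≡x = solve-∀

  inBox⇒e₂-range : ∀ {p} → InBox (w₁ , w₂ , w₃) p → e₂ · p ∈[0, w₂ ]
  inBox⇒e₂-range {x , y , z} (_ , y∈ , _) = subst (_∈[0, w₂ ]) (sym (e₂·p≡y x y z)) y∈
    where
    e₂·p≡y : ∀ x y z → ℤ0 * x + ℤ1 * y + ℤ0 * z ≡ y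
    e₂·p≡y = solve-∀

  inBox⇒e₃-range : ∀ {p} → InBox (w₁ , w₂ , w₃) p → e₃ · p ∈[0, w₃ ]
  inBox⇒e₃-range {x , y , z} (_ , _ , z∈) = subst (_∈[0, w₃ ]) (sym (e₃·p≡z x y z)) z∈
    where
    e₃·p≡z : ∀ x y z → ℤ0 * x + ℤ0 * y + ℤ1 * z ≡ z
    e₃·p≡z = solve-∀

  flag∧inBox⇒isMultiWidth : ∀ {T} → w₁ ≤ w₂ → w₂ ≤ w₃ → Flag w₁ w₂ w₃ T → All (InBox (w₁ , w₂ , w₃)) T →
                            IsMultiWidth T (w₁ , w₂ , w₃)
  flag∧inBox⇒isMultiWidth w₁≤w₂ w₂≤w₃ F box =
    (e₁ , e₂ , e₃ , LinIndep-e ,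
      cong₂ _,_ (≤-antisym (range⇒width≤ (All.map inBox⇒e₁-range box)) (rise⇒≤width (rise₁ 0)))
     (cong₂ _,_ (≤-antisym (range⇒width≤ (All.map inBox⇒e₂-range box)) (rise⇒≤width (rise₂ ℤ0 0)))
                (≤-antisym (range⇒width≤ (All.map inBox⇒e₃-range box)) (rise⇒≤width (rise₃ ℤ0 ℤ0 0))))) ,
    flag⇒≤lex w₁≤w₂ w₂≤w₃ F
    where open Flag F

≤-by-slack : ∀ {k D} X → D ≡ k + X → ℤ0 ≤ X → k ≤ D
≤-by-slack {k} X D≡k+X 0≤X = subst (k ≤_) (sym D≡k+X) (i≤i+j k X {{nonNegative 0≤X}})

0≤+ : ∀ {n} → ℤ0 ≤ + n
0≤+ = +≤+ z≤n

0≤*-nonNeg : ∀ {i j} → ℤ0 ≤ i → ℤ0 ≤ j → ℤ0 ≤ i * j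
0≤*-nonNeg {i} {j} 0≤i 0≤j = subst (_≤ i * j) (*-zeroʳ i) (*-monoˡ-≤-nonNeg i {{nonNegative 0≤i}} 0≤j)

0≤*-nonPos : ∀ {i j} → i ≤ ℤ0 → j ≤ ℤ0 → ℤ0 ≤ i * j
0≤*-nonPos {i} {j} i≤0 j≤0 = subst (_≤ i * j) (*-zeroʳ i) (*-monoˡ-≤-nonPos i {{nonPositive i≤0}} j≤0)

0≤+*+ : ∀ m n → ℤ0 ≤ + m * + n
0≤+*+ m n = 0≤*-nonNeg {+ m} {+ n} 0≤+ 0≤+

x≤2x : ∀ {x} → ℤ0 ≤ x → x ≤ + 2 * x
x≤2x {x} 0≤x = ≤-by-slack x (identity x) 0≤x
  where
  identity : ∀ x → + 2 * x ≡ x + x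
  identity = solve-∀

rise-sameX : ∀ {a b c T k x y z y′ z′} i j → lookup T i ≡ (x , y , z) → lookup T j ≡ (x , y′ , z′) →
             (X : ℤ) → b * (y - y′) + c * (z - z′) ≡ k + X → ℤ0 ≤ X → Rise (a , b , c) T k
rise-sameX {a} {b} {c} {T} {k} {x} {y} {z} {y′} {z′} i j Tᵢ≡ Tⱼ≡ X certificate 0≤X =
  rise i j (subst₂ (λ p q → k ≤ (a , b , c) · p - (a , b , c) · q) (sym Tᵢ≡) (sym Tⱼ≡)
    (≤-by-slack X (trans (sameX a b c x y z y′ z′) certificate) 0≤X))
  where
  sameX : ∀ a b c x y z y′ z′ →
    a * x + b * y + c * z - (a * x + b * y′ + c * z′) ≡ b * (y - y′) + c * (z - z′)
  sameX = solve-∀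

rise-x : ∀ {n T y z y′ z′} i j → lookup T i ≡ (ℤ1 , y , z) → lookup T j ≡ (ℤ0 , y′ , z′) →
         Rise (+[1+ n ] , ℤ0 , ℤ0) T ℤ1
rise-x {n} {T} {y} {z} {y′} {z′} i j Tᵢ≡ Tⱼ≡ =
  rise i j (subst₂ (λ p q → ℤ1 ≤ (+[1+ n ] , ℤ0 , ℤ0) · p - (+[1+ n ] , ℤ0 , ℤ0) · q) (sym Tᵢ≡) (sym Tⱼ≡)
    (≤-by-slack (+ n) (identity (+ n) y z y′ z′) 0≤+))
  where
  identity : ∀ n y z y′ z′ →
    (+ 1 + n) * ℤ1 + ℤ0 * y + ℤ0 * z - ((+ 1 + n) * ℤ0 + ℤ0 * y′ + ℤ0 * z′) ≡ ℤ1 + n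
  identity = solve-∀

rise-y : ∀ {a n w T x z z′} i j → lookup T i ≡ (x , + w , z) → lookup T j ≡ (x , ℤ0 , z′) →
         Rise (a , +[1+ n ] , ℤ0) T (+ w)
rise-y {n = n} {w} {z = z} {z′} i j Tᵢ≡ Tⱼ≡ =
  rise-sameX i j Tᵢ≡ Tⱼ≡ (+ n * + w) (identity (+ n) (+ w) z z′) (0≤+*+ n w)
  where
  identity : ∀ n w z z′ → (+ 1 + n) * (w - ℤ0) + ℤ0 * (z - z′) ≡ w + n * w
  identity = solve-∀

climb : ∀ {a b n w T x y y′} i j → lookup T i ≡ (x , y , + w) → lookup T j ≡ (x , y′ , ℤ0) →
        ℤ0 ≤ b * (y - y′) → Rise (a , b , +[1+ n ]) T (+ w)
climb {b = b} {n} {w} {y = y} {y′} i j Tᵢ≡ Tⱼ≡ 0≤bΔy =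
  rise-sameX i j Tᵢ≡ Tⱼ≡ (b * (y - y′) + + n * + w) (identity b (+ n) (y - y′) (+ w))
             (+-mono-≤ 0≤bΔy (0≤+*+ n w))
  where
  identity : ∀ b n d w → b * d + (+ 1 + n) * (w - ℤ0) ≡ w + (b * d + n * w)
  identity = solve-∀

climb⁺ : ∀ {a b n w T x y y′} i j → lookup T i ≡ (x , y , + w) → lookup T j ≡ (x , y′ , ℤ0) →
         ℤ0 ≤ b → y′ ≤ y → Rise (a , b , +[1+ n ]) T (+ w)
climb⁺ i j Tᵢ≡ Tⱼ≡ 0≤b y′≤y = climb i j Tᵢ≡ Tⱼ≡ (0≤*-nonNeg 0≤b (i≤j⇒0≤j-i y′≤y))

climb⁻ : ∀ {a b n w T x y y′} i j → lookup T i ≡ (x , y , + w) → lookup T j ≡ (x , y′ , ℤ0) →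
         b ≤ ℤ0 → y ≤ y′ → Rise (a , b , +[1+ n ]) T (+ w)
climb⁻ i j Tᵢ≡ Tⱼ≡ b≤0 y≤y′ = climb i j Tᵢ≡ Tⱼ≡ (0≤*-nonPos b≤0 (i≤j⇒i-j≤0 y≤y′))

climb-vertical : ∀ {a b n w T x y} i j → lookup T i ≡ (x , y , + w) → lookup T j ≡ (x , y , ℤ0) →
                 Rise (a , b , +[1+ n ]) T (+ w)
climb-vertical {b = b} {y = y} i j Tᵢ≡ Tⱼ≡ =
  climb i j Tᵢ≡ Tⱼ≡ (≤-reflexive (sym (trans (cong (b *_) (+-inverseʳ y)) (*-zeroʳ b))))

FlagInBox : ℕ → ℕ → Tet → Set
FlagInBox w₂ w₃ T = Flag ℤ1 (+ w₂) (+ w₃) T × All (InBox (ℤ1 , + w₂ , + w₃)) T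

0∈ : ∀ {n} → ℤ0 ∈[0, + n ]
0∈ = 0≤+ , 0≤+

n∈ : ∀ {n} → + n ∈[0, + n ]
n∈ = 0≤+ , ≤-refl

res< : ∀ n {a} → 0 ℕ.< a → res n a ℕ.< a
res< n {ℕ.suc a} _ = n%ℕd<d n (ℕ.suc a)

flagInBox-1i : ∀ {w₂ w₃} → 1 ℕ.< w₂ → w₂ ℕ.≤ w₃ → ∀ y₁ → ℤ0 ≤ y₁ → y₁ ≤ + res (+ w₃ - y₁) w₂ →
  FlagInBox w₂ w₃ ((ℤ0 , ℤ0 , ℤ0) ∷ (ℤ0 , + w₂ , y₁) ∷ (ℤ0 , ℤ0 , + w₃) ∷ (ℤ1 , ℤ0 , ℤ0) ∷ [])
flagInBox-1i {w₂} {w₃} 1<w₂ w₂≤w₃ y₁ 0≤y₁ y₁≤res =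
  mkFlag (λ _ → rise-x (# 3) (# 0) refl refl) (λ _ _ → rise-y (# 1) (# 0) refl refl)
         (λ _ _ _ → climb-vertical (# 2) (# 0) refl refl) ,
  (0∈ , 0∈ , 0∈) ∷ (0∈ , n∈ , 0≤y₁ , y₁≤w₃) ∷ (0∈ , 0∈ , n∈) ∷ (n∈ , 0∈ , 0∈) ∷ []
  where
  y₁≤w₃ : y₁ ≤ + w₃
  y₁≤w₃ = ≤-trans y₁≤res (+≤+ (ℕ.<⇒≤ (ℕ.<-≤-trans (res< (+ w₃ - y₁) (ℕ.<⇒≤ 1<w₂)) w₂≤w₃)))

flagInBox-1ii : ∀ {w₂ w₃} → w₂ ℕ.≤ w₃ → ∀ x₂ y₁ → ℤ0 < x₂ → + 2 * x₂ ≤ + w₂ → ℤ0 ≤ y₁ → y₁ ≤ + w₂ - x₂ →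
  FlagInBox w₂ w₃ ((ℤ0 , ℤ0 , ℤ0) ∷ (ℤ0 , + w₂ , y₁) ∷ (ℤ0 , x₂ , + w₃) ∷ (ℤ1 , ℤ0 , ℤ0) ∷ [])
flagInBox-1ii {w₂} {w₃} w₂≤w₃ x₂ y₁ 0<x₂ 2x₂≤w₂ 0≤y₁ y₁≤w₂-x₂ =
  mkFlag (λ _ → rise-x (# 3) (# 0) refl refl) (λ _ _ → rise-y (# 1) (# 0) refl refl)
    (λ { _ (+ _) _ → climb⁺ (# 2) (# 0) refl refl 0≤+ 0≤x₂
       ; _ -[1+ m ] n →
           rise-sameX (# 2) (# 1) refl refl _ (certificate (+ m) (+ n) x₂ y₁ (+ w₂) (+ w₃)) (0≤slack m n) }) ,
  (0∈ , 0∈ , 0∈) ∷ (0∈ , n∈ , 0≤y₁ , y₁≤w₃) ∷ (0∈ , (0≤x₂ , x₂≤w₂) , n∈) ∷ (n∈ , 0∈ , 0∈) ∷ []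
  where
  0≤x₂ : ℤ0 ≤ x₂
  0≤x₂ = <⇒≤ 0<x₂
  x₂≤w₂ : x₂ ≤ + w₂
  x₂≤w₂ = ≤-trans (x≤2x 0≤x₂) 2x₂≤w₂
  y₁≤w₃ : y₁ ≤ + w₃
  y₁≤w₃ = ≤-trans y₁≤w₂-x₂ (≤-trans (i-j≤i (+ w₂) x₂ {{nonNegative 0≤x₂}}) (+≤+ w₂≤w₃))
  certificate : ∀ m n x₂ y₁ w₂ w₃ → (- (+ 1 + m)) * (x₂ - w₂) + (+ 1 + n) * (w₃ - y₁)
                  ≡ w₃ + ((w₂ - x₂ - y₁) + m * (w₂ - x₂) + n * (w₃ - y₁))
  certificate = solve-∀
  0≤slack : ∀ m n → ℤ0 ≤ (+ w₂ - x₂ - y₁) + + m * (+ w₂ - x₂) + + n * (+ w₃ - y₁)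
  0≤slack m n = +-mono-≤ (+-mono-≤ (i≤j⇒0≤j-i y₁≤w₂-x₂) (0≤*-nonNeg {+ m} 0≤+ (i≤j⇒0≤j-i x₂≤w₂)))
                         (0≤*-nonNeg {+ n} 0≤+ (i≤j⇒0≤j-i y₁≤w₃))

flagInBox-1iii : ∀ {w₂ w₃} x₂ y₀ → ℤ1 < x₂ → + 2 * x₂ < + w₂ → ℤ0 < y₀ → y₀ < x₂ → w₂ ℕ.< w₃ →
  FlagInBox w₂ w₃ ((ℤ0 , ℤ0 , y₀) ∷ (ℤ0 , + w₂ , ℤ0) ∷ (ℤ0 , x₂ , + w₃) ∷ (ℤ1 , ℤ0 , ℤ0) ∷ [])
flagInBox-1iii {w₂} {w₃} x₂ y₀ 1<x₂ 2x₂<w₂ 0<y₀ y₀<x₂ w₂<w₃ =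
  mkFlag (λ _ → rise-x (# 3) (# 0) refl refl) (λ _ _ → rise-y (# 1) (# 0) refl refl)
    (λ { _ (+ 0) _ → climb⁻ (# 2) (# 1) refl refl ≤-refl x₂≤w₂
       ; _ -[1+ _ ] _ → climb⁻ (# 2) (# 1) refl refl -≤+ x₂≤w₂
       ; _ +[1+ m ] n →
           rise-sameX (# 2) (# 0) refl refl _ (certificate (+ m) (+ n) x₂ y₀ (+ w₃)) (0≤slack m n) }) ,
  (0∈ , 0∈ , 0≤y₀ , y₀≤w₃) ∷ (0∈ , n∈ , 0∈) ∷ (0∈ , (0≤x₂ , x₂≤w₂) , n∈) ∷ (n∈ , 0∈ , 0∈) ∷ []
  where
  0≤x₂ : ℤ0 ≤ x₂
  0≤x₂ = <⇒≤ (<-trans (+<+ (s≤s z≤n)) 1<x₂)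
  x₂≤w₂ : x₂ ≤ + w₂
  x₂≤w₂ = ≤-trans (x≤2x 0≤x₂) (<⇒≤ 2x₂<w₂)
  0≤y₀ : ℤ0 ≤ y₀
  0≤y₀ = <⇒≤ 0<y₀
  y₀≤w₃ : y₀ ≤ + w₃
  y₀≤w₃ = ≤-trans (<⇒≤ y₀<x₂) (≤-trans x₂≤w₂ (+≤+ (ℕ.<⇒≤ w₂<w₃)))
  certificate : ∀ m n x₂ y₀ w₃ → (+ 1 + m) * (x₂ - ℤ0) + (+ 1 + n) * (w₃ - y₀)
                  ≡ w₃ + ((x₂ - y₀) + m * x₂ + n * (w₃ - y₀))
  certificate = solve-∀
  0≤slack : ∀ m n → ℤ0 ≤ (x₂ - y₀) + + m * x₂ + + n * (+ w₃ - y₀)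
  0≤slack m n = +-mono-≤ (+-mono-≤ (i≤j⇒0≤j-i (<⇒≤ y₀<x₂)) (0≤*-nonNeg {+ m} 0≤+ 0≤x₂))
                         (0≤*-nonNeg {+ n} 0≤+ (i≤j⇒0≤j-i y₀≤w₃))

flagInBox-2 : ∀ {w₂ w₃} → w₂ ℕ.≤ w₃ → ∀ z₁ → ℤ0 ≤ z₁ → + 2 * z₁ ≤ + w₂ →
  FlagInBox w₂ w₃ (0ᵥ ∷ (ℤ0 , + w₂ , z₁) ∷ (ℤ1 , ℤ0 , ℤ0) ∷ (ℤ1 , ℤ0 , + w₃) ∷ [])
flagInBox-2 w₂≤w₃ z₁ 0≤z₁ 2z₁≤w₂ =
  mkFlag (λ _ → rise-x (# 2) (# 0) refl refl) (λ _ _ → rise-y (# 1) (# 0) refl refl)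
         (λ _ _ _ → climb-vertical (# 3) (# 2) refl refl) ,
  (0∈ , 0∈ , 0∈) ∷ (0∈ , n∈ , 0≤z₁ , ≤-trans (x≤2x 0≤z₁) (≤-trans 2z₁≤w₂ (+≤+ w₂≤w₃))) ∷
  (n∈ , 0∈ , 0∈) ∷ (n∈ , 0∈ , n∈) ∷ []

flagInBox-3 : ∀ {w₂ w₃} → w₂ ℕ.≤ w₃ → ∀ y₁ z₁ → ℤ0 < y₁ → y₁ ≤ + w₂ → + w₃ - + w₂ ≤ z₁ → z₁ ≤ + w₃ →
  FlagInBox w₂ w₃ (0ᵥ ∷ (ℤ0 , + w₂ , z₁) ∷ (ℤ1 , ℤ0 , + w₃) ∷ (ℤ1 , y₁ , ℤ0) ∷ [])
flagInBox-3 {w₂} {w₃} w₂≤w₃ y₁ z₁ 0<y₁ y₁≤w₂ w₃-w₂≤z₁ z₁≤w₃ =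
  mkFlag (λ _ → rise-x (# 2) (# 0) refl refl) (λ _ _ → rise-y (# 1) (# 0) refl refl)
    (λ { _ (+ 0) _ → climb⁻ (# 2) (# 3) refl refl ≤-refl (<⇒≤ 0<y₁)
       ; _ -[1+ _ ] _ → climb⁻ (# 2) (# 3) refl refl -≤+ (<⇒≤ 0<y₁)
       ; _ +[1+ m ] n →
           rise-sameX (# 1) (# 0) refl refl _ (certificate (+ m) (+ n) (+ w₂) (+ w₃) z₁) (0≤slack m n) }) ,
  (0∈ , 0∈ , 0∈) ∷ (0∈ , n∈ , 0≤z₁ , z₁≤w₃) ∷ (n∈ , 0∈ , n∈) ∷ (n∈ , (<⇒≤ 0<y₁ , y₁≤w₂) , 0∈) ∷ []
  where
  0≤z₁ : ℤ0 ≤ z₁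
  0≤z₁ = ≤-trans (i≤j⇒0≤j-i (+≤+ w₂≤w₃)) w₃-w₂≤z₁
  certificate : ∀ m n w₂ w₃ z₁ → (+ 1 + m) * (w₂ - ℤ0) + (+ 1 + n) * (z₁ - ℤ0)
                  ≡ w₃ + (m * w₂ + n * z₁ + (z₁ - (w₃ - w₂)))
  certificate = solve-∀
  0≤slack : ∀ m n → ℤ0 ≤ + m * + w₂ + + n * z₁ + (z₁ - (+ w₃ - + w₂))
  0≤slack m n = +-mono-≤ (+-mono-≤ (0≤+*+ m w₂) (0≤*-nonNeg {+ n} 0≤+ 0≤z₁)) (i≤j⇒0≤j-i w₃-w₂≤z₁)

flagInBox-4 : ∀ {w₂ w₃} → w₂ ℕ.≤ w₃ → ∀ y₁ z₁ → ℤ0 < z₁ → z₁ < y₁ → y₁ < + w₂ →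
  FlagInBox w₂ w₃ (0ᵥ ∷ (ℤ0 , + w₂ , + w₃) ∷ (ℤ1 , ℤ0 , + w₃) ∷ (ℤ1 , y₁ , z₁) ∷ [])
flagInBox-4 {w₂} {w₃} w₂≤w₃ y₁ z₁ 0<z₁ z₁<y₁ y₁<w₂ =
  mkFlag (λ _ → rise-x (# 2) (# 0) refl refl) (λ _ _ → rise-y (# 1) (# 0) refl refl)
    (λ { _ (+ _) _ → climb⁺ (# 1) (# 0) refl refl 0≤+ 0≤+
       ; _ -[1+ m ] n →
           rise-sameX (# 2) (# 3) refl refl _ (certificate (+ m) (+ n) y₁ z₁ (+ w₃)) (0≤slack m n) }) ,
  (0∈ , 0∈ , 0∈) ∷ (0∈ , n∈ , n∈) ∷ (n∈ , 0∈ , n∈) ∷ (n∈ , (0≤y₁ , <⇒≤ y₁<w₂) , <⇒≤ 0<z₁ , z₁≤w₃) ∷ []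
  where
  0≤y₁ : ℤ0 ≤ y₁
  0≤y₁ = <⇒≤ (<-trans 0<z₁ z₁<y₁)
  z₁≤w₃ : z₁ ≤ + w₃
  z₁≤w₃ = <⇒≤ (<-≤-trans (<-trans z₁<y₁ y₁<w₂) (+≤+ w₂≤w₃))
  certificate : ∀ m n y₁ z₁ w₃ → (- (+ 1 + m)) * (ℤ0 - y₁) + (+ 1 + n) * (w₃ - z₁)
                  ≡ w₃ + ((y₁ - z₁) + m * y₁ + n * (w₃ - z₁))
  certificate = solve-∀
  0≤slack : ∀ m n → ℤ0 ≤ (y₁ - z₁) + + m * y₁ + + n * (+ w₃ - z₁)
  0≤slack m n = +-mono-≤ (+-mono-≤ (i≤j⇒0≤j-i (<⇒≤ z₁<y₁)) (0≤*-nonNeg {+ m} 0≤+ 0≤y₁))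
                         (0≤*-nonNeg {+ n} 0≤+ (i≤j⇒0≤j-i z₁≤w₃))

flagInBox-11a : ∀ {w₃} → FlagInBox 1 w₃ (0ᵥ ∷ (ℤ0 , ℤ1 , ℤ0) ∷ (ℤ0 , ℤ0 , + w₃) ∷ (ℤ1 , ℤ0 , ℤ0) ∷ [])
flagInBox-11a =
  mkFlag (λ _ → rise-x (# 3) (# 0) refl refl) (λ _ _ → rise-y (# 1) (# 0) refl refl)
         (λ _ _ _ → climb-vertical (# 2) (# 0) refl refl) ,
  (0∈ , 0∈ , 0∈) ∷ (0∈ , n∈ , 0∈) ∷ (0∈ , 0∈ , n∈) ∷ (n∈ , 0∈ , 0∈) ∷ []

flagInBox-11b : ∀ {w₃} → 1 ℕ.< w₃ →
  FlagInBox 1 w₃ (0ᵥ ∷ (ℤ0 , ℤ1 , + w₃ - ℤ1) ∷ (ℤ1 , ℤ0 , + w₃) ∷ (ℤ1 , ℤ1 , ℤ0) ∷ [])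
flagInBox-11b {w₃} 1<w₃ =
  mkFlag (λ _ → rise-x (# 2) (# 0) refl refl) (λ _ _ → rise-y (# 1) (# 0) refl refl)
    (λ { _ (+ 0) _ → climb⁻ (# 2) (# 3) refl refl ≤-refl 0≤+
       ; _ -[1+ _ ] _ → climb⁻ (# 2) (# 3) refl refl -≤+ 0≤+
       ; _ +[1+ m ] n →
           rise-sameX (# 1) (# 0) refl refl _ (certificate (+ m) (+ n) (+ w₃))
             (+-mono-≤ (0≤+ {m}) (0≤*-nonNeg {+ n} 0≤+ 0≤w₃-1)) }) ,
  (0∈ , 0∈ , 0∈) ∷ (0∈ , n∈ , 0≤w₃-1 , i-j≤i (+ w₃) ℤ1) ∷ (n∈ , 0∈ , n∈) ∷ (n∈ , n∈ , 0∈) ∷ []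
  where
  0≤w₃-1 : ℤ0 ≤ + w₃ - ℤ1
  0≤w₃-1 = i≤j⇒0≤j-i (+≤+ (ℕ.<⇒≤ 1<w₃))
  certificate : ∀ m n w₃ → (+ 1 + m) * (ℤ1 - ℤ0) + (+ 1 + n) * ((w₃ - ℤ1) - ℤ0) ≡ w₃ + (m + n * (w₃ - ℤ1))
  certificate = solve-∀

flagInBox-11c : ∀ {w₃} → FlagInBox 1 w₃ (0ᵥ ∷ (ℤ0 , ℤ1 , + w₃) ∷ (ℤ1 , ℤ0 , + w₃) ∷ (ℤ1 , ℤ1 , ℤ0) ∷ [])
flagInBox-11c =
  mkFlag (λ _ → rise-x (# 2) (# 0) refl refl) (λ _ _ → rise-y (# 1) (# 0) refl refl)
    (λ { _ (+ _) _ → climb⁺ (# 1) (# 0) refl refl 0≤+ 0≤+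
       ; _ -[1+ _ ] _ → climb⁻ (# 2) (# 3) refl refl -≤+ 0≤+ }) ,
  (0∈ , 0∈ , 0∈) ∷ (0∈ , n∈ , n∈) ∷ (n∈ , 0∈ , n∈) ∷ (n∈ , n∈ , 0∈) ∷ []

flagInBox-111a : FlagInBox 1 1 (0ᵥ ∷ (ℤ1 , ℤ0 , ℤ0) ∷ (ℤ0 , ℤ1 , ℤ0) ∷ (ℤ0 , ℤ0 , ℤ1) ∷ [])
flagInBox-111a =
  mkFlag (λ _ → rise-x (# 1) (# 0) refl refl) (λ _ _ → rise-y (# 2) (# 0) refl refl)
         (λ _ _ _ → climb-vertical (# 3) (# 0) refl refl) ,
  (0∈ , 0∈ , 0∈) ∷ (n∈ , 0∈ , 0∈) ∷ (0∈ , n∈ , 0∈) ∷ (0∈ , 0∈ , n∈) ∷ []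

S₃⇒flagInBox : ∀ {w₂ w₃ T} → S₃ w₂ w₃ T → FlagInBox w₂ w₃ T
S₃⇒flagInBox (t1 1<w₂ w₂≤w₃ _ _ _ (s-i y₁ 0≤y₁ y₁≤res)) = flagInBox-1i 1<w₂ w₂≤w₃ y₁ 0≤y₁ y₁≤res
S₃⇒flagInBox (t1 _ w₂≤w₃ _ _ _ (s-ii x₂ y₁ 0<x₂ 2x₂≤w₂ 0≤y₁ y₁≤w₂-x₂ _)) =
  flagInBox-1ii w₂≤w₃ x₂ y₁ 0<x₂ 2x₂≤w₂ 0≤y₁ y₁≤w₂-x₂
S₃⇒flagInBox (t1 _ _ _ _ _ (s-iii x₂ y₀ 1<x₂ 2x₂<w₂ 0<y₀ y₀<x₂ w₂<w₃)) =
  flagInBox-1iii x₂ y₀ 1<x₂ 2x₂<w₂ 0<y₀ y₀<x₂ w₂<w₃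
S₃⇒flagInBox (t2 _ w₂≤w₃ z₁ 0≤z₁ 2z₁≤w₂) = flagInBox-2 w₂≤w₃ z₁ 0≤z₁ 2z₁≤w₂
S₃⇒flagInBox (t3 _ w₂≤w₃ y₁ z₁ 0<y₁ y₁≤w₂ w₃-w₂≤z₁ z₁≤w₃ _) =
  flagInBox-3 w₂≤w₃ y₁ z₁ 0<y₁ y₁≤w₂ w₃-w₂≤z₁ z₁≤w₃
S₃⇒flagInBox (t4 _ w₂≤w₃ y₁ z₁ 0<z₁ z₁<y₁ y₁<w₂ _) = flagInBox-4 w₂≤w₃ y₁ z₁ 0<z₁ z₁<y₁ y₁<w₂
S₃⇒flagInBox (u1 refl _)     = flagInBox-11a
S₃⇒flagInBox (u2 refl 1<w₃)  = flagInBox-11b 1<w₃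
S₃⇒flagInBox (u3 refl _)     = flagInBox-11c
S₃⇒flagInBox (v1 refl refl)  = flagInBox-111a
S₃⇒flagInBox (v2 refl refl)  = flagInBox-11c  -- the case w₃ = 1 of the third tetrahedron of S_{1,1,w₃}

proposition4p4 : ∀ (w₂ w₃ : ℕ) → 1 ℕ.≤ w₂ → w₂ ℕ.≤ w₃ → ∀ (T : Tet) → S₃ w₂ w₃ T →
    IsMultiWidth T (+ 1 , + w₂ , + w₃)
proposition4p4 w₂ w₃ 1≤w₂ w₂≤w₃ T s =
  uncurry (flag∧inBox⇒isMultiWidth (+≤+ 1≤w₂) (+≤+ w₂≤w₃)) (S₃⇒flagInBox s)
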